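{- Say a word $\sigma=\sigma_1\cdots\sigma_n$ over $\{1,\dots,k\}$ avoids $123$ if there is no index $i$ with $\sigma_i<\sigma_{i+1}<\sigma_{i+2}$, and let $F_{123}(x;k)=\sum_{n\ge0}f_{123}(n,k)x^n$, where $f_{123}(n,k)$ is the number of such words of length $n$. Define $a_{3m}=1$, $a_{3m+1}=-1$, $a_{3m+2}=0$ for all $m\ge0$. Then for all $k\ge0$, \[ F_{123}(x;k)=\frac{1}{\sum_{j=0}^{k}a_j\binom{k}{j}x^j}. \]
   Context: The empty word (length $0$) is counted once; for $k=0$ there are no words of positive length. -}

module Defs where

open import Data.Nat using (ℕ; zero; suc; _∸_)
open import Data.Nat.Combinatorics using (_C_)
open import Data.Fin using (Fin; _<_; _<?_)
open import Data.Fin.Base using ()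
open import Data.Vec using (Vec; []; _∷_)
open import Data.List using (List; [_]; concatMap; map; length; filter; upTo; foldr)
open import Data.List.Base using ()
open import Data.Integer using (ℤ; +_; -_; _*_; _+_)
open import Data.Product using (_×_; _,_)
open import Relation.Nullary using (¬_; Dec; yes; no)
open import Relation.Nullary.Decidable using (¬?; _×-dec_; _⊎-dec_)
open import Data.Sum using (_⊎_; inj₁; inj₂)

-- Words of length n over the alphabet {1,…,k}, letter j+1 represented by (j : Fin k).
-- All words of length n over Fin k (each exactly once).
allWords : (k n : ℕ) → List (Vec (Fin k) n)
allWords k zero = [ [] ]
allWords k (suc n) = concatMap (λ a → map (a ∷_) (allWords k n)) (Data.List.allFin k)

data Has123 {k : ℕ} : {n : ℕ} → Vec (Fin k) n → Set where
  here  : ∀ {n} {a b c : Fin k} {w : Vec (Fin k) n} →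
          a < b → b < c → Has123 (a ∷ b ∷ c ∷ w)
  there : ∀ {n} {a : Fin k} {w : Vec (Fin k) n} →
          Has123 w → Has123 (a ∷ w)

Avoids123 : {k n : ℕ} → Vec (Fin k) n → Set
Avoids123 w = ¬ Has123 w

has123? : {k n : ℕ} (w : Vec (Fin k) n) → Dec (Has123 w)
has123? [] = no λ ()
has123? (a ∷ []) = no λ { (there ()) }
has123? (a ∷ b ∷ []) = no λ { (there (there ())) }
has123? (a ∷ b ∷ c ∷ w) with a <? b | b <? c | has123? (b ∷ c ∷ w)
... | yes p | yes q | _ = yes (here p q)
... | _ | _ | yes h = yes (there h)
... | no p | _ | no h = no λ { (here p' q') → p p' ; (there h') → h h' }
... | yes _ | no q | no h = no λ { (here p' q') → q q' ; (there h') → h h' }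

avoids123? : {k n : ℕ} (w : Vec (Fin k) n) → Dec (Avoids123 w)
avoids123? w = ¬? (has123? w)

f123 : (n k : ℕ) → ℕ
f123 n k = length (filter avoids123? (allWords k n))

a : ℕ → ℤ
a zero = + 1
a (suc zero) = - (+ 1)
a (suc (suc zero)) = + 0
a (suc (suc (suc j))) = a j

-- coefficient of x^j in the denominator ∑_{j=0}^{k} a_j C(k,j) x^j
-- (k C j = 0 for j > k, so this is the polynomial coefficient for every j)
denomCoeff : (k j : ℕ) → ℤ
denomCoeff k j = a j * (+ (k C j))

sumTo : ℕ → (ℕ → ℤ) → ℤ
sumTo n g = foldr (λ i acc → g i + acc) (+ 0) (upTo (suc n))

δ₀ : ℕ → ℤ
δ₀ zero = + 1
δ₀ (suc _) = + 0

module Submission where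

-- Reading C(k,i) as the number of strictly increasing words of length i, the left-hand side is a
-- sum over all words w of length n of the weights a_|u| of the factorisations w = u v with u
-- strictly increasing and v avoiding 123. For a nonempty word only the factorisations with
-- |u| ∈ {m-2, m-1, m} can contribute, m being the length of the longest increasing prefix, and
-- their suffixes v are all 123-avoiding or all not; so the weights cancel because any three
-- consecutive a_j sum to 0 (and a_2 = 0 takes care of m = 1).

open import Defs
open import Data.Nat using (ℕ; zero; suc; _∸_; _≤ᵇ_; _<ᵇ_)
import Data.Nat as ℕ
open import Data.Nat.Combinatorics using (_C_; nCk+nC[k+1]≡[n+1]C[k+1])
open import Data.Integer using (ℤ; +_; 0ℤ; _+_; _*_; -_)
open import Data.Integer.Properties
  using (+-*-semiring; pos-+; *-identityˡ; *-identityʳ; *-zeroʳ; +-identityˡ; +-identityʳ; +-inverseʳ; *-assoc)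
open import Data.Integer.Tactic.RingSolver using (solve-∀)
open import Algebra.Properties.Semiring.Sum +-*-semiring
  using (sum-syntax; sum-cong-≗; sum-replicate-zero; ∑-distrib-+; ∑-comm; *-distribˡ-sum; *-distribʳ-sum)
open import Data.Bool using (Bool; true; false; not; _∧_; _∨_; if_then_else_)
open import Data.Bool.Properties using (∧-zeroʳ)
open import Data.Fin as Fin using (Fin; zero; suc; toℕ; _<?_)
open import Data.Product using (_×_; _,_; uncurry)
open import Data.Sum using (_⊎_; inj₁; inj₂; [_,_])
open import Data.Vec using (Vec; []; _∷_)
open import Data.List using (List; []; _∷_; _++_; filter; length; map; concatMap; tabulate; applyUpTo; foldr)
open import Data.List.Properties using (filter-++; length-++)
open import Function using (_∘_; id)
open import Level using (0ℓ)
open import Relation.Nullary using (does; map′)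
open import Relation.Nullary.Decidable using (does-≡; _×-dec_; _⊎-dec_)
open import Relation.Unary using (Pred; Decidable)
open import Relation.Binary.PropositionalEquality using (_≡_; refl; sym; trans; cong; cong₂; module ≡-Reasoning)
open ≡-Reasoning

χ : Bool → ℤ
χ true = + 1
χ false = 0ℤ

wordSum : ∀ k n → (Vec (Fin k) n → ℤ) → ℤ
wordSum k zero F = F []
wordSum k (suc n) F = ∑[ x < k ] wordSum k n (λ w → F (x ∷ w))

module _ {k : ℕ} where

  wordSum-cong : ∀ n {F G : Vec (Fin k) n → ℤ} → (∀ w → F w ≡ G w) → wordSum k n F ≡ wordSum k n G
  wordSum-cong zero F≗G = F≗G []
  wordSum-cong (suc n) F≗G = sum-cong-≗ λ x → wordSum-cong n (λ w → F≗G (x ∷ w))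

  wordSum-distrib-+ : ∀ n (F G : Vec (Fin k) n → ℤ) →
    wordSum k n (λ w → F w + G w) ≡ wordSum k n F + wordSum k n G
  wordSum-distrib-+ zero F G = refl
  wordSum-distrib-+ (suc n) F G = trans
    (sum-cong-≗ λ x → wordSum-distrib-+ n (λ w → F (x ∷ w)) (λ w → G (x ∷ w)))
    (∑-distrib-+ (λ x → wordSum k n (λ w → F (x ∷ w))) (λ x → wordSum k n (λ w → G (x ∷ w))))

  *-distribˡ-wordSum : ∀ n c (F : Vec (Fin k) n → ℤ) → c * wordSum k n F ≡ wordSum k n (λ w → c * F w)
  *-distribˡ-wordSum zero c F = refl
  *-distribˡ-wordSum (suc n) c F = trans
    (*-distribˡ-sum c (λ x → wordSum k n (λ w → F (x ∷ w))))
    (sum-cong-≗ λ x → *-distribˡ-wordSum n c (λ w → F (x ∷ w)))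

  wordSum-zero : ∀ n → wordSum k n (λ _ → 0ℤ) ≡ 0ℤ
  wordSum-zero zero = refl
  wordSum-zero (suc n) = trans (sum-cong-≗ {k} λ _ → wordSum-zero n) (sum-replicate-zero k)

module _ {A : Set} {P : Pred A 0ℓ} (P? : Decidable P) where

  length-filter-++ : ∀ xs ys →
    length (filter P? (xs ++ ys)) ≡ length (filter P? xs) ℕ.+ length (filter P? ys)
  length-filter-++ xs ys = trans (cong length (filter-++ P? xs ys)) (length-++ (filter P? xs))

  length-filter-map : ∀ {B : Set} (f : B → A) xs → length (filter P? (map f xs)) ≡ length (filter (P? ∘ f) xs)
  length-filter-map f [] = refl
  length-filter-map f (x ∷ xs) with does (P? (f x))
  ... | true = cong suc (length-filter-map f xs)
  ... | false = length-filter-map f xs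

  length-filter-concatMap-tabulate : ∀ {B : Set} {m} (g : B → List A) (f : Fin m → B) →
    + length (filter P? (concatMap g (tabulate f))) ≡ ∑[ i < m ] (+ length (filter P? (g (f i))))
  length-filter-concatMap-tabulate {m = zero} g f = refl
  length-filter-concatMap-tabulate {m = suc m} g f = begin
    + (length (filter P? (g (f zero) ++ rest)))
      ≡⟨ cong +_ (length-filter-++ (g (f zero)) rest) ⟩
    + (length (filter P? (g (f zero))) ℕ.+ length (filter P? rest))
      ≡⟨ pos-+ (length (filter P? (g (f zero)))) (length (filter P? rest)) ⟩
    + length (filter P? (g (f zero))) + + length (filter P? rest)
      ≡⟨ cong (_+_ (+ length (filter P? (g (f zero))))) (length-filter-concatMap-tabulate g (f ∘ suc)) ⟩
    ∑[ i < suc m ] (+ length (filter P? (g (f i)))) ∎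
    where
    rest : List A
    rest = concatMap g (tabulate (f ∘ suc))

length-filter-allWords : ∀ k n {P : Pred (Vec (Fin k) n) 0ℓ} (P? : Decidable P) →
  + length (filter P? (allWords k n)) ≡ wordSum k n (χ ∘ does ∘ P?)
length-filter-allWords k zero P? with does (P? [])
... | true = refl
... | false = refl
length-filter-allWords k (suc n) P? = begin
  + length (filter P? (allWords k (suc n)))
    ≡⟨ length-filter-concatMap-tabulate P? (λ x → map (x ∷_) (allWords k n)) id ⟩
  ∑[ x < k ] (+ length (filter P? (map (x ∷_) (allWords k n))))
    ≡⟨ sum-cong-≗ {k} (λ x → cong +_ (length-filter-map P? (x ∷_) (allWords k n))) ⟩
  ∑[ x < k ] (+ length (filter (P? ∘ (x ∷_)) (allWords k n)))
    ≡⟨ sum-cong-≗ {k} (λ x → length-filter-allWords k n (P? ∘ (x ∷_))) ⟩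
  wordSum k (suc n) (χ ∘ does ∘ P?) ∎

foldr-applyUpTo : ∀ (g : ℕ → ℤ) (f : ℕ → ℕ) m →
  foldr (λ i acc → g i + acc) 0ℤ (applyUpTo f m) ≡ ∑[ i < m ] g (f (toℕ i))
foldr-applyUpTo g f zero = refl
foldr-applyUpTo g f (suc m) = cong (_+_ (g (f 0))) (foldr-applyUpTo g (f ∘ suc) m)

sumTo≡∑ : ∀ n g → sumTo n g ≡ ∑[ i < suc n ] g (toℕ i)
sumTo≡∑ n g = foldr-applyUpTo g id (suc n)

suc-≤ᵇ-suc : ∀ m n → (suc m ≤ᵇ suc n) ≡ (m ≤ᵇ n)
suc-≤ᵇ-suc zero n = refl
suc-≤ᵇ-suc (suc m) n = refl

hockey-stick : ∀ k b i →
  ∑[ x < k ] (χ (b ≤ᵇ toℕ x) * + ((k ∸ suc (toℕ x)) C i)) ≡ + ((k ∸ b) C suc i)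
hockey-stick zero zero i = refl
hockey-stick zero (suc b) i = refl
hockey-stick (suc k) zero i = begin
  + 1 * + (k C i) + ∑[ x < k ] (χ (0 ≤ᵇ toℕ x) * + ((k ∸ suc (toℕ x)) C i))
    ≡⟨ cong₂ _+_ (*-identityˡ (+ (k C i))) (hockey-stick k zero i) ⟩
  + (k C i) + + (k C suc i)
    ≡⟨ pos-+ (k C i) (k C suc i) ⟨
  + (k C i ℕ.+ k C suc i)
    ≡⟨ cong +_ (nCk+nC[k+1]≡[n+1]C[k+1] k i) ⟩
  + (suc k C suc i) ∎
hockey-stick (suc k) (suc b) i = begin
  0ℤ + ∑[ x < k ] (χ (suc b ≤ᵇ suc (toℕ x)) * + ((k ∸ suc (toℕ x)) C i))
    ≡⟨ +-identityˡ _ ⟩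
  ∑[ x < k ] (χ (suc b ≤ᵇ suc (toℕ x)) * + ((k ∸ suc (toℕ x)) C i))
    ≡⟨ sum-cong-≗ {k} (λ x → cong (λ t → χ t * + ((k ∸ suc (toℕ x)) C i)) (suc-≤ᵇ-suc b (toℕ x))) ⟩
  ∑[ x < k ] (χ (b ≤ᵇ toℕ x) * + ((k ∸ suc (toℕ x)) C i))
    ≡⟨ hockey-stick k b i ⟩
  + ((k ∸ b) C suc i) ∎

module _ {k : ℕ} where

  ascent : Fin k → Fin k → Bool
  ascent x y = toℕ x <ᵇ toℕ y

  -- avoidsAfter r x w tells whether p ∷ x ∷ w avoids 123, for a letter p below x if r = true
  -- and not below x (or absent) if r = false.
  avoidsAfter : ∀ {n} → Bool → Fin k → Vec (Fin k) n → Bool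
  avoidsAfter ascended x [] = true
  avoidsAfter ascended x (y ∷ w) =
    if ascent x y then not ascended ∧ avoidsAfter true y w else avoidsAfter false y w

  avoids : ∀ {n} → Vec (Fin k) n → Bool
  avoids [] = true
  avoids (x ∷ w) = avoidsAfter false x w

  has123 : ∀ {n} → Vec (Fin k) n → Bool
  has123 w = does (has123? w)

  has123-∷∷∷ : ∀ {n} x y z (w : Vec (Fin k) n) →
    has123 (x ∷ y ∷ z ∷ w) ≡ (ascent x y ∧ ascent y z) ∨ has123 (y ∷ z ∷ w)
  has123-∷∷∷ x y z w = does-≡ (has123? (x ∷ y ∷ z ∷ w))
    (map′ [ uncurry here , there ] split ((x <? y ×-dec y <? z) ⊎-dec has123? (y ∷ z ∷ w)))
    where
    split : Has123 (x ∷ y ∷ z ∷ w) → (x Fin.< y × y Fin.< z) ⊎ Has123 (y ∷ z ∷ w)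
    split (here x<y y<z) = inj₁ (x<y , y<z)
    split (there h) = inj₂ h

  has123-skip : ∀ {n} x y (w : Vec (Fin k) n) → ascent x y ≡ false → has123 (x ∷ y ∷ w) ≡ has123 (y ∷ w)
  has123-skip x y [] _ = refl
  has123-skip x y (z ∷ w) xy rewrite has123-∷∷∷ x y z w | xy = refl

  avoidsAfter-false-correct : ∀ {n} x (w : Vec (Fin k) n) → avoidsAfter false x w ≡ not (has123 (x ∷ w))
  avoidsAfter-ascent-correct : ∀ {n} p x (w : Vec (Fin k) n) →
    avoidsAfter (ascent p x) x w ≡ not (has123 (p ∷ x ∷ w))

  avoidsAfter-false-correct x [] = refl
  avoidsAfter-false-correct x (y ∷ w) with ascent x y in xy
  ... | true  = trans (cong (λ b → avoidsAfter b y w) (sym xy)) (avoidsAfter-ascent-correct x y w)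
  ... | false = trans (avoidsAfter-false-correct y w) (cong not (sym (has123-skip x y w xy)))

  avoidsAfter-ascent-correct p x [] = refl
  avoidsAfter-ascent-correct p x (y ∷ w) rewrite has123-∷∷∷ p x y w with ascent x y in xy
  ... | false rewrite ∧-zeroʳ (ascent p x) | has123-skip x y w xy = avoidsAfter-false-correct y w
  ... | true with ascent p x
  ...   | true  = refl
  ...   | false = trans (cong (λ b → avoidsAfter b y w) (sym xy)) (avoidsAfter-ascent-correct x y w)

  avoids-correct : ∀ {n} (w : Vec (Fin k) n) → does (avoids123? w) ≡ avoids w
  avoids-correct [] = refl
  avoids-correct (x ∷ w) = sym (avoidsAfter-false-correct x w)

module _ {k n : ℕ} (x y : Fin k) (w : Vec (Fin k) n) where

  avoidsAfter-∷-ascent : ∀ r → ascent x y ≡ true → avoidsAfter r x (y ∷ w) ≡ not r ∧ avoidsAfter true y w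
  avoidsAfter-∷-ascent r xy rewrite xy = refl

  avoidsAfter-∷-descent : ∀ r → ascent x y ≡ false → avoidsAfter r x (y ∷ w) ≡ avoidsAfter false y w
  avoidsAfter-∷-descent r xy rewrite xy = refl

f123≡wordSum : ∀ n k → + f123 n k ≡ wordSum k n (χ ∘ avoids)
f123≡wordSum n k = trans (length-filter-allWords k n avoids123?)
  (wordSum-cong n (cong χ ∘ avoids-correct))

-- The sum of c |u| over the factorisations w = u v with u strictly increasing with all letters
-- ≥ b, and v avoiding 123.
splitWeight : ∀ {k n} → (ℕ → ℤ) → ℕ → Vec (Fin k) n → ℤ
splitWeight c b [] = c 0
splitWeight c b (x ∷ w) =
  c 0 * χ (avoids (x ∷ w)) + χ (b ≤ᵇ toℕ x) * splitWeight (c ∘ suc) (suc (toℕ x)) w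

-- C(k ∸ b, i) counts the strictly increasing words of length i over Fin k with letters ≥ b.
convolution : ℕ → (ℕ → ℤ) → ℕ → ℕ → ℤ
convolution k c b n = ∑[ i < suc n ] (c (toℕ i) * (+ ((k ∸ b) C toℕ i) * + f123 (n ∸ toℕ i) k))

∑-inner-sum-comm : ∀ {m n} (α γ : Fin m → ℤ) (g : Fin n → ℤ) (β : Fin n → Fin m → ℤ) →
  ∑[ i < m ] (α i * (∑[ x < n ] (g x * β x i) * γ i)) ≡
  ∑[ x < n ] (g x * ∑[ i < m ] (α i * (β x i * γ i)))
∑-inner-sum-comm {m} {n} α γ g β = begin
  ∑[ i < m ] (α i * (∑[ x < n ] (g x * β x i) * γ i))
    ≡⟨ sum-cong-≗ {m} expand ⟩
  ∑[ i < m ] ∑[ x < n ] (g x * (α i * (β x i * γ i)))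
    ≡⟨ ∑-comm (λ i x → g x * (α i * (β x i * γ i))) ⟩
  ∑[ x < n ] ∑[ i < m ] (g x * (α i * (β x i * γ i)))
    ≡⟨ sum-cong-≗ {n} (λ x → *-distribˡ-sum (g x) (λ i → α i * (β x i * γ i))) ⟨
  ∑[ x < n ] (g x * ∑[ i < m ] (α i * (β x i * γ i))) ∎
  where
  rearrange : ∀ a g b c → a * (g * b * c) ≡ g * (a * (b * c))
  rearrange = solve-∀
  expand : ∀ i → α i * (∑[ x < n ] (g x * β x i) * γ i) ≡ ∑[ x < n ] (g x * (α i * (β x i * γ i)))
  expand i = begin
    α i * (∑[ x < n ] (g x * β x i) * γ i)
      ≡⟨ cong (α i *_) (*-distribʳ-sum (γ i) (λ x → g x * β x i)) ⟩
    α i * ∑[ x < n ] (g x * β x i * γ i)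
      ≡⟨ *-distribˡ-sum (α i) (λ x → g x * β x i * γ i) ⟩
    ∑[ x < n ] (α i * (g x * β x i * γ i))
      ≡⟨ sum-cong-≗ {n} (λ x → rearrange (α i) (g x) (β x i) (γ i)) ⟩
    ∑[ x < n ] (g x * (α i * (β x i * γ i))) ∎

convolution-suc : ∀ k c b n → convolution k c b (suc n) ≡
  c 0 * + f123 (suc n) k + ∑[ x < k ] (χ (b ≤ᵇ toℕ x) * convolution k (c ∘ suc) (suc (toℕ x)) n)
convolution-suc k c b n = begin
  c 0 * (+ 1 * + f123 (suc n) k) + ∑[ i < suc n ] (c (suc (toℕ i)) * (+ ((k ∸ b) C suc (toℕ i)) * f i))
    ≡⟨ cong₂ _+_ (cong (c 0 *_) (*-identityˡ (+ f123 (suc n) k)))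
                 (sum-cong-≗ {suc n} λ i →
                    cong (λ t → c (suc (toℕ i)) * (t * f i)) (sym (hockey-stick k b (toℕ i)))) ⟩
  c 0 * + f123 (suc n) k + ∑[ i < suc n ] (c (suc (toℕ i)) * (∑[ x < k ] (guard x * binom x i) * f i))
    ≡⟨ cong (_+_ (c 0 * + f123 (suc n) k)) (∑-inner-sum-comm {suc n} {k} (c ∘ suc ∘ toℕ) f guard binom) ⟩
  c 0 * + f123 (suc n) k + ∑[ x < k ] (guard x * convolution k (c ∘ suc) (suc (toℕ x)) n) ∎
  where
  f : Fin (suc n) → ℤ
  f i = + f123 (n ∸ toℕ i) k
  guard : Fin k → ℤ
  guard x = χ (b ≤ᵇ toℕ x)
  binom : Fin k → Fin (suc n) → ℤ
  binom x i = + ((k ∸ suc (toℕ x)) C toℕ i)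

convolution≡wordSum : ∀ k c b n → convolution k c b n ≡ wordSum k n (splitWeight c b)
convolution≡wordSum k c b zero = trans (+-identityʳ (c 0 * + 1)) (*-identityʳ (c 0))
convolution≡wordSum k c b (suc n) = begin
  convolution k c b (suc n)
    ≡⟨ convolution-suc k c b n ⟩
  c 0 * + f123 (suc n) k + ∑[ x < k ] (χ (b ≤ᵇ toℕ x) * convolution k (c ∘ suc) (suc (toℕ x)) n)
    ≡⟨ cong₂ _+_ (cong (c 0 *_) (f123≡wordSum (suc n) k))
                 (sum-cong-≗ {k} λ x →
                    cong (χ (b ≤ᵇ toℕ x) *_) (convolution≡wordSum k (c ∘ suc) (suc (toℕ x)) n)) ⟩
  c 0 * ∑[ x < k ] A x + ∑[ x < k ] (χ (b ≤ᵇ toℕ x) * K x)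
    ≡⟨ cong (_+ ∑[ x < k ] (χ (b ≤ᵇ toℕ x) * K x)) (*-distribˡ-sum (c 0) A) ⟩
  ∑[ x < k ] (c 0 * A x) + ∑[ x < k ] (χ (b ≤ᵇ toℕ x) * K x)
    ≡⟨ ∑-distrib-+ (λ x → c 0 * A x) (λ x → χ (b ≤ᵇ toℕ x) * K x) ⟨
  ∑[ x < k ] (c 0 * A x + χ (b ≤ᵇ toℕ x) * K x)
    ≡⟨ sum-cong-≗ {k} split ⟩
  wordSum k (suc n) (splitWeight c b) ∎
  where
  A K : Fin k → ℤ
  A x = wordSum k n (λ w → χ (avoids (x ∷ w)))
  K x = wordSum k n (splitWeight (c ∘ suc) (suc (toℕ x)))
  split : ∀ x → c 0 * A x + χ (b ≤ᵇ toℕ x) * K x ≡ wordSum k n (λ w → splitWeight c b (x ∷ w))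
  split x = trans
    (cong₂ _+_ (*-distribˡ-wordSum n (c 0) _) (*-distribˡ-wordSum n (χ (b ≤ᵇ toℕ x)) _))
    (sym (wordSum-distrib-+ n _ _))

ZeroSumTriples : (ℕ → ℤ) → Set
ZeroSumTriples c = ∀ i → c i + c (suc i) + c (suc (suc i)) ≡ 0ℤ

module _ (c : ℕ → ℤ) (triples : ZeroSumTriples c) where

  zeroSumTriples-scaled : ∀ t → c 0 * t + c 1 * t ≡ - (c 2 * t)
  zeroSumTriples-scaled t = begin
    c 0 * t + c 1 * t                      ≡⟨ rearrange (c 0) (c 1) (c 2) t ⟩
    (c 0 + c 1 + c 2) * t + - (c 2 * t)    ≡⟨ cong (λ s → s * t + - (c 2 * t)) (triples 0) ⟩
    0ℤ * t + - (c 2 * t)                   ≡⟨ +-identityˡ (- (c 2 * t)) ⟩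
    - (c 2 * t)                            ∎
    where
    rearrange : ∀ p q r t → p * t + q * t ≡ (p + q + r) * t + - (r * t)
    rearrange = solve-∀

  zeroSumTriples-period : c 3 ≡ c 0
  zeroSumTriples-period = begin
    c 3                                                ≡⟨ rearrange (c 0) (c 1) (c 2) (c 3) ⟩
    (c 1 + c 2 + c 3) + - (c 0 + c 1 + c 2) + c 0      ≡⟨ cong₂ (λ s t → s + - t + c 0) (triples 1) (triples 0) ⟩
    0ℤ + - 0ℤ + c 0                                    ≡⟨ +-identityˡ (c 0) ⟩
    c 0                                                ∎
    where
    rearrange : ∀ p q r s → s ≡ (q + r + s) + - (p + q + r) + p
    rearrange = solve-∀

  zeroSumTriples-cancel : ∀ t → c 0 * t + - (c 3 * t) ≡ 0ℤ
  zeroSumTriples-cancel t = begin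
    c 0 * t + - (c 3 * t)    ≡⟨ cong (λ s → c 0 * t + - (s * t)) zeroSumTriples-period ⟩
    c 0 * t + - (c 0 * t)    ≡⟨ +-inverseʳ (c 0 * t) ⟩
    0ℤ                       ∎

module _ {k n : ℕ} (c : ℕ → ℤ) (b : ℕ) (x : Fin k) (w : Vec (Fin k) n) where

  splitWeight-above : (b ≤ᵇ toℕ x) ≡ true →
    splitWeight c b (x ∷ w) ≡ c 0 * χ (avoids (x ∷ w)) + splitWeight (c ∘ suc) (suc (toℕ x)) w
  splitWeight-above bx rewrite bx = cong (_+_ (c 0 * χ (avoids (x ∷ w)))) (*-identityˡ _)

  splitWeight-below : (b ≤ᵇ toℕ x) ≡ false → splitWeight c b (x ∷ w) ≡ c 0 * χ (avoids (x ∷ w))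
  splitWeight-below bx rewrite bx = +-identityʳ _

splitWeight-cancel : ∀ c → ZeroSumTriples c → ∀ {k n} b (x : Fin k) (w : Vec (Fin k) n) →
  (b ≤ᵇ toℕ x) ≡ true →
  splitWeight c b (x ∷ w) ≡ - (c 2 * χ (avoidsAfter true x w))
splitWeight-cancel c triples b x [] bx = begin
  splitWeight c b (x ∷ [])      ≡⟨ splitWeight-above c b x [] bx ⟩
  c 0 * + 1 + c 1               ≡⟨ cong (_+_ (c 0 * + 1)) (*-identityʳ (c 1)) ⟨
  c 0 * + 1 + c 1 * + 1         ≡⟨ zeroSumTriples-scaled c triples (+ 1) ⟩
  - (c 2 * + 1)                 ∎
splitWeight-cancel c triples b x (y ∷ w) bx = byAscent (ascent x y) refl
  where
  byAscent : ∀ β → ascent x y ≡ β →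
    splitWeight c b (x ∷ y ∷ w) ≡ - (c 2 * χ (avoidsAfter true x (y ∷ w)))
  byAscent true xy = begin
    splitWeight c b (x ∷ y ∷ w)
      ≡⟨ splitWeight-above c b x (y ∷ w) bx ⟩
    c 0 * χ (avoidsAfter false x (y ∷ w)) + splitWeight (c ∘ suc) (suc (toℕ x)) (y ∷ w)
      ≡⟨ cong₂ _+_ (cong (λ t → c 0 * χ t) (avoidsAfter-∷-ascent x y w false xy))
                   (splitWeight-cancel (c ∘ suc) (triples ∘ suc) (suc (toℕ x)) y w xy) ⟩
    c 0 * χ (avoidsAfter true y w) + - (c 3 * χ (avoidsAfter true y w))
      ≡⟨ zeroSumTriples-cancel c triples (χ (avoidsAfter true y w)) ⟩
    0ℤ
      ≡⟨ cong -_ (*-zeroʳ (c 2)) ⟨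
    - (c 2 * χ false)
      ≡⟨ cong (λ t → - (c 2 * χ t)) (avoidsAfter-∷-ascent x y w true xy) ⟨
    - (c 2 * χ (avoidsAfter true x (y ∷ w))) ∎
  byAscent false xy = begin
    splitWeight c b (x ∷ y ∷ w)
      ≡⟨ splitWeight-above c b x (y ∷ w) bx ⟩
    c 0 * χ (avoidsAfter false x (y ∷ w)) + splitWeight (c ∘ suc) (suc (toℕ x)) (y ∷ w)
      ≡⟨ cong₂ _+_ (cong (λ t → c 0 * χ t) (avoidsAfter-∷-descent x y w false xy))
                   (splitWeight-below (c ∘ suc) (suc (toℕ x)) y w xy) ⟩
    c 0 * χ (avoids (y ∷ w)) + c 1 * χ (avoids (y ∷ w))
      ≡⟨ zeroSumTriples-scaled c triples (χ (avoids (y ∷ w))) ⟩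
    - (c 2 * χ (avoids (y ∷ w)))
      ≡⟨ cong (λ t → - (c 2 * χ t)) (avoidsAfter-∷-descent x y w true xy) ⟨
    - (c 2 * χ (avoidsAfter true x (y ∷ w))) ∎

a-zeroSumTriples : ZeroSumTriples a
a-zeroSumTriples zero = refl
a-zeroSumTriples (suc zero) = refl
a-zeroSumTriples (suc (suc zero)) = refl
a-zeroSumTriples (suc (suc (suc i))) = a-zeroSumTriples i

wordSum-splitWeight-a : ∀ k n → wordSum k n (splitWeight a 0) ≡ δ₀ n
wordSum-splitWeight-a k zero = refl
wordSum-splitWeight-a k (suc n) = trans
  (wordSum-cong {k} (suc n) {F = splitWeight a 0} {G = λ _ → 0ℤ}
    λ { (x ∷ w) → splitWeight-cancel a a-zeroSumTriples 0 x w refl })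
  (wordSum-zero {k} (suc n))

theorem3p13 : (k n : ℕ) →
    sumTo n (λ i → denomCoeff k i * (+ f123 (n ∸ i) k)) ≡ δ₀ n
theorem3p13 k n = begin
  sumTo n (λ i → denomCoeff k i * + f123 (n ∸ i) k)
    ≡⟨ sumTo≡∑ n (λ i → denomCoeff k i * + f123 (n ∸ i) k) ⟩
  ∑[ i < suc n ] (a (toℕ i) * + (k C toℕ i) * + f123 (n ∸ toℕ i) k)
    ≡⟨ sum-cong-≗ {suc n} (λ i → *-assoc (a (toℕ i)) (+ (k C toℕ i)) (+ f123 (n ∸ toℕ i) k)) ⟩
  convolution k a 0 n
    ≡⟨ convolution≡wordSum k a 0 n ⟩
  wordSum k n (splitWeight a 0)
    ≡⟨ wordSum-splitWeight-a k n ⟩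
  δ₀ n ∎
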